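{- Let $\Gamma$ be a two-dimensional book-embedding of a weighted biconnected outerplanar graph $G=(V,E,\omega)$ whose area is $\sum_{e\in E}\omega(e)$, and let $\mathcal L$ be the $1$-page book-embedding supporting $\Gamma$. Let $e\in E$ and let $e_1,\dots,e_k$ be the edges of $E$ around which $e$ directly wraps in $\mathcal L$. Then $y_{\min}(e)=y_{\max}(e_1)=\dots=y_{\max}(e_k)$.
   Context: A weighted graph has a positive weight $\omega(e)$ on each edge. A $1$-page book-embedding is a linear order $\mathcal L$ of the vertices with no two edges $(u,v),(w,z)$ satisfying $u\prec w\prec v\prec z$; an edge $e_1=(u_1,v_1)$ wraps around a distinct edge $e_2=(u_2,v_2)$ (and $e_2$ is nested into $e_1$) if $u_1\preceq u_2\prec v_2\preceq v_1$. $e_1$ directly wraps around $e_2$ if $e_1$ wraps around $e_2$ and there is no edge $e_3$ such that $e_1$ wraps around $e_3$ and $e_3$ wraps around $e_2$. A two-dimensional book-embedding $\Gamma$ of $G$ consists of a $1$-page book-embedding $\mathcal L$ (supporting $\Gamma$) and a representation $\mathcal R$ such that: (1) each vertex $v$ gets coordinates $(x(v),0)$ with $x(u)<x(v)$ whenever $u\prec_{\mathcal L} v$; (2) each edge $e=(u,v)$ with $u\prec_{\mathcal L}v$ is represented by an axis-parallel rectangle $\mathcal R(e)=[x_{\min}(e),x_{\max}(e)]\times[y_{\min}(e),y_{\max}(e)]$ with $y_{\min}(e)\ge0$, $x_{\min}(e)=x(u)$, $x_{\max}(e)=x(v)$, area equal to $\omega(e)$, and $y_{\min}(e)=\max\{y_{\max}(e'):e'\text{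 nested into }e\}$ (taken as $0$ if no edge is nested into $e$). The area of $\Gamma$ is the area of the smallest axis-parallel rectangle enclosing all rectangles of $\mathcal R$. -}

module Defs where

open import Level using (Level; 0ℓ) renaming (suc to lsuc)
open import Data.Nat as ℕ using (ℕ; zero; suc)
open import Data.Fin as Fin using (Fin; toℕ)
open import Data.Product using (Σ; ∃; ∃-syntax; _×_; _,_; proj₁; proj₂)
open import Data.Sum using (_⊎_)
open import Relation.Binary.PropositionalEquality using (_≡_; _≢_)
open import Relation.Nullary using (¬_)
open import Relation.Binary.Structures using (IsStrictTotalOrder)
open import Algebra.Structures using (IsCommutativeRing)
open import Function.Definitions using (Injective)
open import Data.Unit using (⊤)

-- Ordered fields (the coordinates / weights live in an ordered field;
-- the paper uses ℝ, which is an instance).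

record OrderedField : Set₁ where
  infixl 6 _+_ _-_
  infixl 7 _*_
  infix  4 _<_ _≤_
  field
    Carrier : Set
    _+_ _*_ : Carrier → Carrier → Carrier
    -_      : Carrier → Carrier
    0# 1#   : Carrier
    _<_     : Carrier → Carrier → Set
    isCommutativeRing  : IsCommutativeRing _≡_ _+_ _*_ -_ 0# 1#
    0≢1                : 0# ≢ 1#
    inverse            : ∀ x → x ≢ 0# → ∃[ y ] (x * y ≡ 1#)
    isStrictTotalOrder : IsStrictTotalOrder _≡_ _<_
    +-mono-<           : ∀ {a b} c → a < b → a + c < b + c
    *-pos              : ∀ {a b} → 0# < a → 0# < b → 0# < a * b

  _-_ : Carrier → Carrier → Carrier
  a - b = a + (- b)

  _≤_ : Carrier → Carrier → Set
  a ≤ b = (a < b) ⊎ (a ≡ b)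

record Graph (n m : ℕ) : Set where
  field
    endpoints : Fin m → Fin n × Fin n

  src tgt : Fin m → Fin n
  src e = proj₁ (endpoints e)
  tgt e = proj₂ (endpoints e)

SimpleGraph : ∀ {n m} → Graph n m → Set
SimpleGraph {n} {m} G =
  (∀ e → src e ≢ tgt e) ×
  (∀ e f → ((src e ≡ src f) × (tgt e ≡ tgt f)) ⊎ ((src e ≡ tgt f) × (tgt e ≡ src f)) → e ≡ f)
  where open Graph G

module _ {n m : ℕ} (G : Graph n m) where
  open Graph G

  Adjacent : Fin n → Fin n → Set
  Adjacent u v = ∃[ e ] (((src e ≡ u) × (tgt e ≡ v)) ⊎ ((src e ≡ v) × (tgt e ≡ u)))

  data Walk (Ok : Fin n → Set) : Fin n → Fin n → Set where
    here  : ∀ {u} → Ok u → Walk Ok u u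
    there : ∀ {u w v} → Ok u → Adjacent u w → Walk Ok w v → Walk Ok u v

  Connected : Set
  Connected = ∀ u v → Walk (λ _ → ⊤) u v

  Biconnected : Set
  Biconnected =
    (3 ℕ.≤ n) × Connected ×
    (∀ x u v → u ≢ x → v ≢ x → Walk (λ w → w ≢ x) u v)

module BookEmbedding {n m : ℕ} (G : Graph n m) (pos : Fin n → Fin n) where
  open Graph G

  _≺_ : Fin n → Fin n → Set
  u ≺ v = toℕ (pos u) ℕ.< toℕ (pos v)

  _≼_ : Fin n → Fin n → Set
  u ≼ v = toℕ (pos u) ℕ.≤ toℕ (pos v)

  left right : Fin m → Fin n
  left e with toℕ (pos (src e)) ℕ.≤? toℕ (pos (tgt e))
  ... | Relation.Nullary.yes _ = src e
  ... | Relation.Nullary.no  _ = tgt e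
  right e with toℕ (pos (src e)) ℕ.≤? toℕ (pos (tgt e))
  ... | Relation.Nullary.yes _ = tgt e
  ... | Relation.Nullary.no  _ = src e

  IsLinearOrder : Set
  IsLinearOrder = Injective _≡_ _≡_ pos

  NoCrossing : Set
  NoCrossing = ∀ e f → ¬ ((left e ≺ left f) × (left f ≺ right e) × (right e ≺ right f))

  IsOnePageBookEmbedding : Set
  IsOnePageBookEmbedding = IsLinearOrder × NoCrossing

  WrapsAround : Fin m → Fin m → Set
  WrapsAround e₁ e₂ =
    (e₁ ≢ e₂) × (left e₁ ≼ left e₂) × (left e₂ ≺ right e₂) × (right e₂ ≼ right e₁)

  DirectlyWrapsAround : Fin m → Fin m → Set
  DirectlyWrapsAround e₁ e₂ =
    WrapsAround e₁ e₂ × ¬ (∃[ e₃ ] (WrapsAround e₁ e₃ × WrapsAround e₃ e₂))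

Outerplanar : ∀ {n m} → Graph n m → Set
Outerplanar {n} G = ∃[ pos ] BookEmbedding.IsOnePageBookEmbedding G pos

module TwoDim (F : OrderedField) where
  open OrderedField F

  IsMaxOf : ∀ {m} → (Fin m → Carrier) → Carrier → Set
  IsMaxOf f v = (∃[ i ] (f i ≡ v)) × (∀ i → f i ≤ v)

  IsMinOf : ∀ {m} → (Fin m → Carrier) → Carrier → Set
  IsMinOf f v = (∃[ i ] (f i ≡ v)) × (∀ i → v ≤ f i)

  sumF : ∀ {m} → (Fin m → Carrier) → Carrier
  sumF {zero}  f = 0#
  sumF {suc m} f = f Fin.zero + sumF (λ i → f (Fin.suc i))

  PositiveWeights : ∀ {m} → (Fin m → Carrier) → Set
  PositiveWeights ω = ∀ e → 0# < ω e

  -- A representation: x-coordinates of vertices and y-extent of each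
  -- edge rectangle (its x-extent is forced: [x(left e), x(right e)]).
  record Representation (n m : ℕ) : Set where
    field
      x    : Fin n → Carrier
      ymin : Fin m → Carrier
      ymax : Fin m → Carrier

  module _ {n m : ℕ} (G : Graph n m) (ω : Fin m → Carrier)
           (pos : Fin n → Fin n) (R : Representation n m) where
    open BookEmbedding G pos
    open Representation R

    xmin xmax : Fin m → Carrier
    xmin e = x (left e)
    xmax e = x (right e)

    IsTwoDimBookEmbedding : Set
    IsTwoDimBookEmbedding =
      IsOnePageBookEmbedding ×
      (∀ u v → u ≺ v → x u < x v) ×
      (∀ e → 0# ≤ ymin e) ×
      (∀ e → (xmax e - xmin e) * (ymax e - ymin e) ≡ ω e) ×
      (∀ e → (∀ e' → WrapsAround e e' → ymax e' ≤ ymin e) ×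
             ((∃[ e' ] (WrapsAround e e' × ymax e' ≡ ymin e))
              ⊎ ((∀ e' → ¬ WrapsAround e e') × ymin e ≡ 0#)))

    HasArea : Carrier → Set
    HasArea A = ∃[ X₀ ] ∃[ X₁ ] ∃[ Y₀ ] ∃[ Y₁ ]
      (IsMinOf xmin X₀ × IsMaxOf xmax X₁ × IsMinOf ymin Y₀ × IsMaxOf ymax Y₁ ×
       ((X₁ - X₀) * (Y₁ - Y₀) ≡ A))

-- Cut the plane into the vertical slabs between consecutive vertices. Edges whose
-- rectangles lie over a common slab are nested (the order has no crossings), so these
-- rectangles are stacked with disjoint y-extents and the column they form over a slab is
-- at most as high as the bounding box. Summing slab width times column height recovers the
-- total weight, which therefore is at most the box area, strictly so if some spanned column
-- is short. If e directly wraps around e' but y_max(e') < y_min(e), the column over the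
-- first slab of e' misses the band between them: a rectangle there lies inside e' or
-- around e, since directness leaves no edge in between.

module Submission where

open import Defs
open import Data.Nat using (ℕ)
open import Data.Fin using (Fin)
open import Relation.Binary.PropositionalEquality using (_≡_)

open import Level using (0ℓ)
open import Data.Nat as ℕ using (zero; suc)
import Data.Nat.Properties as ℕ
open import Data.Fin as Fin using (toℕ; inject₁; fromℕ<)
open import Data.Fin.Patterns using (0F; 1F)
import Data.Fin.Properties as Fin
open import Data.Product using (_×_; _,_; proj₁; proj₂)
open import Data.Sum using (_⊎_; inj₁; inj₂; [_,_]′; swap)
open import Data.Empty using (⊥-elim)
open import Function using (_∘_; case_of_)
open import Function.Definitions using (Injective; StrictlySurjective)
open import Relation.Nullary using (¬_; Dec; yes; no; contradiction)
open import Relation.Nullary.Decidable using (_×-dec_; ¬?)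
open import Relation.Unary using (Pred; Decidable)
open import Relation.Binary.PropositionalEquality
  using (_≢_; refl; sym; trans; cong; cong₂; subst; subst₂; module ≡-Reasoning)
open import Relation.Binary.Bundles using (StrictTotalOrder)
open import Relation.Binary.Definitions using (tri<; tri≈; tri>)
import Relation.Binary.Construct.StrictToNonStrict
import Relation.Binary.Reasoning.StrictPartialOrder
open import Algebra.Bundles using (CommutativeRing)

injective⇒strictlySurjective : ∀ {n} {f : Fin n → Fin n} →
  Injective _≡_ _≡_ f → StrictlySurjective _≡_ f
injective⇒strictlySurjective {suc n} {f} f-injective q with Fin.any? (λ v → f v Fin.≟ q)
... | yes hit = hit
... | no miss = contradiction (Fin.injective⇒≤ squeeze-injective) ℕ.1+n≰n
  where
  avoids : ∀ v → q ≢ f v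
  avoids v q≡fv = miss (v , sym q≡fv)

  squeeze : Fin (suc n) → Fin n
  squeeze v = Fin.punchOut (avoids v)

  squeeze-injective : Injective _≡_ _≡_ squeeze
  squeeze-injective eq = f-injective (Fin.punchOut-injective (avoids _) (avoids _) eq)

InRange : ∀ {k} → Fin (suc k) → Fin (suc k) → Pred (Fin k) 0ℓ
InRange a b p = toℕ a ℕ.≤ toℕ p × toℕ p ℕ.< toℕ b

inRange? : ∀ {k} (a b : Fin (suc k)) → Decidable (InRange a b)
inRange? a b p = (toℕ a ℕ.≤? toℕ p) ×-dec (toℕ p ℕ.<? toℕ b)

module OrderedFieldProperties (F : OrderedField) where
  open OrderedField F

  commutativeRing : CommutativeRing 0ℓ 0ℓ
  commutativeRing = record { isCommutativeRing = isCommutativeRing }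

  strictTotalOrder : StrictTotalOrder 0ℓ 0ℓ 0ℓ
  strictTotalOrder = record { isStrictTotalOrder = isStrictTotalOrder }

  open CommutativeRing commutativeRing public
    using (semiring; +-assoc; +-comm; +-identityˡ; +-identityʳ; -‿inverseˡ; -‿inverseʳ; zeroˡ; zeroʳ)
  open import Algebra.Properties.Ring (CommutativeRing.ring commutativeRing)
    using (x[y-z]≈xy-xz)
  open import Algebra.Properties.Group (CommutativeRing.+-group commutativeRing)
    using (//-rightDividesˡ; x∙y⁻¹≈ε⇒x≈y)
  open import Algebra.Properties.CommutativeSemigroup
    (CommutativeRing.+-commutativeSemigroup commutativeRing) public
    using (x∙yz≈y∙xz)
  open StrictTotalOrder strictTotalOrder public
    using (compare; <-respˡ-≈; <-respʳ-≈)
    renaming (irrefl to <-irrefl; trans to <-trans; asym to <-asym)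
  private module NonStrict = Relation.Binary.Construct.StrictToNonStrict _≡_ _<_
  module ≤-Reasoning = Relation.Binary.Reasoning.StrictPartialOrder
    (StrictTotalOrder.strictPartialOrder strictTotalOrder)

  [y-x]+[z-y]≡z-x : ∀ x y z → (y - x) + (z - y) ≡ z - x
  [y-x]+[z-y]≡z-x x y z = begin
    (y + - x) + (z + - y)  ≡⟨ +-comm (y + - x) (z + - y) ⟩
    (z + - y) + (y + - x)  ≡⟨ +-assoc z (- y) (y + - x) ⟩
    z + (- y + (y + - x))  ≡⟨ cong (z +_) (+-assoc (- y) y (- x)) ⟨
    z + ((- y + y) + - x)  ≡⟨ cong (λ w → z + (w + - x)) (-‿inverseˡ y) ⟩
    z + (0# + - x)         ≡⟨ cong (z +_) (+-identityˡ (- x)) ⟩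
    z + - x                ∎
    where open ≡-Reasoning

  [x-y]+y≡x : ∀ x y → (x - y) + y ≡ x
  [x-y]+y≡x x y = //-rightDividesˡ y x

  ≤-refl : ∀ {x} → x ≤ x
  ≤-refl = inj₂ refl

  ≤-trans : ∀ {x y z} → x ≤ y → y ≤ z → x ≤ z
  ≤-trans = NonStrict.trans (StrictTotalOrder.isEquivalence strictTotalOrder)
    (StrictTotalOrder.<-resp-≈ strictTotalOrder) <-trans

  <-≤-trans : ∀ {x y z} → x < y → y ≤ z → x < z
  <-≤-trans = NonStrict.<-≤-trans <-trans <-respʳ-≈

  ≤-<-trans : ∀ {x y z} → x ≤ y → y < z → x < z
  ≤-<-trans = NonStrict.≤-<-trans sym <-trans <-respˡ-≈

  _≤?_ : ∀ x y → Dec (x ≤ y)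
  _≤?_ = NonStrict.decidable′ compare

  +-monoʳ-< : ∀ {x y} z → x < y → z + x < z + y
  +-monoʳ-< {x} {y} z x<y = subst₂ _<_ (+-comm x z) (+-comm y z) (+-mono-< z x<y)

  +-monoˡ-≤ : ∀ {x y} z → x ≤ y → x + z ≤ y + z
  +-monoˡ-≤ z (inj₁ x<y) = inj₁ (+-mono-< z x<y)
  +-monoˡ-≤ z (inj₂ refl) = ≤-refl

  +-monoʳ-≤ : ∀ {x y} z → x ≤ y → z + x ≤ z + y
  +-monoʳ-≤ z (inj₁ x<y) = inj₁ (+-monoʳ-< z x<y)
  +-monoʳ-≤ z (inj₂ refl) = ≤-refl

  +-mono-≤ : ∀ {x y u v} → x ≤ y → u ≤ v → x + u ≤ y + v
  +-mono-≤ x≤y u≤v = ≤-trans (+-monoˡ-≤ _ x≤y) (+-monoʳ-≤ _ u≤v)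

  +-mono-<-≤ : ∀ {x y u v} → x < y → u ≤ v → x + u < y + v
  +-mono-<-≤ x<y u≤v = <-≤-trans (+-mono-< _ x<y) (+-monoʳ-≤ _ u≤v)

  +-mono-≤-< : ∀ {x y u v} → x ≤ y → u < v → x + u < y + v
  +-mono-≤-< x≤y u<v = ≤-<-trans (+-monoˡ-≤ _ x≤y) (+-monoʳ-< _ u<v)

  x<y⇒0<y-x : ∀ {x y} → x < y → 0# < y - x
  x<y⇒0<y-x {x} x<y = subst (_< _) (-‿inverseʳ x) (+-mono-< (- x) x<y)

  0<y-x⇒x<y : ∀ {x y} → 0# < y - x → x < y
  0<y-x⇒x<y {x} {y} 0<y-x = subst₂ _<_ (+-identityˡ x) ([x-y]+y≡x y x) (+-mono-< x 0<y-x)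

  x≤y⇒0≤y-x : ∀ {x y} → x ≤ y → 0# ≤ y - x
  x≤y⇒0≤y-x (inj₁ x<y) = inj₁ (x<y⇒0<y-x x<y)
  x≤y⇒0≤y-x {x} (inj₂ refl) = inj₂ (sym (-‿inverseʳ x))

  0≤y-x⇒x≤y : ∀ {x y} → 0# ≤ y - x → x ≤ y
  0≤y-x⇒x≤y (inj₁ 0<y-x) = inj₁ (0<y-x⇒x<y 0<y-x)
  0≤y-x⇒x≤y {x} {y} (inj₂ 0≡y-x) = inj₂ (sym (x∙y⁻¹≈ε⇒x≈y y x (sym 0≡y-x)))

  *-monoʳ-< : ∀ {x y z} → 0# < z → x < y → z * x < z * y
  *-monoʳ-< {x} {y} {z} 0<z x<y =
    0<y-x⇒x<y (subst (0# <_) (x[y-z]≈xy-xz z y x) (*-pos 0<z (x<y⇒0<y-x x<y)))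

  *-monoʳ-≤ : ∀ {x y z} → 0# ≤ z → x ≤ y → z * x ≤ z * y
  *-monoʳ-≤ _           (inj₂ refl) = ≤-refl
  *-monoʳ-≤ (inj₁ 0<z)  (inj₁ x<y)  = inj₁ (*-monoʳ-< 0<z x<y)
  *-monoʳ-≤ {x} {y} (inj₂ refl) (inj₁ _) = inj₂ (trans (zeroˡ x) (sym (zeroˡ y)))

  0<x*y⇒0≤y : ∀ {x y} → 0# < x → 0# < x * y → 0# ≤ y
  0<x*y⇒0≤y {x} {y} 0<x 0<x*y with compare 0# y
  ... | tri< 0<y _ _ = inj₁ 0<y
  ... | tri≈ _ 0≡y _ = inj₂ 0≡y
  ... | tri> _ _ y<0 = contradiction (subst (x * y <_) (zeroʳ x) (*-monoʳ-< 0<x y<0)) (<-asym 0<x*y)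

  select : {A : Set} → Dec A → Carrier → Carrier
  select (yes _) c = c
  select (no _)  _ = 0#

  select-yes : {A : Set} (d : Dec A) → A → ∀ c → select d c ≡ c
  select-yes (yes _) _ _ = refl
  select-yes (no ¬a) a _ = contradiction a ¬a

  select-no : {A : Set} (d : Dec A) → ¬ A → ∀ c → select d c ≡ 0#
  select-no (yes a) ¬a _ = contradiction a ¬a
  select-no (no _)  _  _ = refl

  select-cong : {A B : Set} → (A → B) → (B → A) → (d : Dec A) (d′ : Dec B) → ∀ c →
    select d c ≡ select d′ c
  select-cong A⇒B _ (yes a)  d′ c = sym (select-yes d′ (A⇒B a) c)
  select-cong _ B⇒A (no ¬a) d′ c = sym (select-no d′ (¬a ∘ B⇒A) c)

  select-*-comm : {A : Set} (d : Dec A) → ∀ x y → select d x * y ≡ x * select d y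
  select-*-comm (yes _) x y = refl
  select-*-comm (no _)  x y = trans (zeroˡ y) (sym (zeroʳ x))

  select-split : {A B : Set} (d : Dec A) (d′ : Dec B) → ∀ c →
    select d c ≡ select (d ×-dec d′) c + select (d ×-dec ¬? d′) c
  select-split (yes _) (yes _) c = sym (+-identityʳ c)
  select-split (yes _) (no _)  c = sym (+-identityˡ c)
  select-split (no _)  _       _ = sym (+-identityˡ 0#)

  open import Algebra.Properties.Semiring.Sum semiring public
    using (sum; sum-syntax; sum-cong-≗; ∑-distrib-+; ∑-comm; *-distribˡ-sum; *-distribʳ-sum;
           sum-replicate-zero)

  sumF≡sum : ∀ {m} (f : Fin m → Carrier) → TwoDim.sumF F f ≡ sum f
  sumF≡sum {zero}  f = refl
  sumF≡sum {suc m} f = cong (f Fin.zero +_) (sumF≡sum (f ∘ Fin.suc))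

  ∑-select-none : ∀ {k} {P : Pred (Fin k) 0ℓ} (P? : Decidable P) (c : Fin k → Carrier) →
    (∀ i → ¬ P i) → ∑[ i < k ] select (P? i) (c i) ≡ 0#
  ∑-select-none {k} P? c none =
    trans (sum-cong-≗ (λ i → select-no (P? i) (none i) (c i))) (sum-replicate-zero k)

  ∑-select-split : ∀ {k} {P Q : Pred (Fin k) 0ℓ} (P? : Decidable P) (Q? : Decidable Q)
    (c : Fin k → Carrier) →
    ∑[ i < k ] select (P? i) (c i) ≡
      ∑[ i < k ] select (P? i ×-dec Q? i) (c i) + ∑[ i < k ] select (P? i ×-dec ¬? (Q? i)) (c i)
  ∑-select-split P? Q? c =
    trans (sum-cong-≗ (λ i → select-split (P? i) (Q? i) (c i)))
      (∑-distrib-+ (λ i → select (P? i ×-dec Q? i) (c i)) (λ i → select (P? i ×-dec ¬? (Q? i)) (c i)))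

  ∑-mono-≤ : ∀ {k} {f g : Fin k → Carrier} → (∀ i → f i ≤ g i) → sum f ≤ sum g
  ∑-mono-≤ {zero}  _   = ≤-refl
  ∑-mono-≤ {suc k} f≤g = +-mono-≤ (f≤g Fin.zero) (∑-mono-≤ (f≤g ∘ Fin.suc))

  ∑-mono-< : ∀ {k} {f g : Fin k → Carrier} → (∀ i → f i ≤ g i) → ∀ i → f i < g i → sum f < sum g
  ∑-mono-< {suc k} f≤g Fin.zero    fi<gi = +-mono-<-≤ fi<gi (∑-mono-≤ (f≤g ∘ Fin.suc))
  ∑-mono-< {suc k} f≤g (Fin.suc i) fi<gi = +-mono-≤-< (f≤g Fin.zero) (∑-mono-< (f≤g ∘ Fin.suc) i fi<gi)

module IntervalSums (F : OrderedField) where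
  open OrderedField F
  open OrderedFieldProperties F

  Δ : ∀ {k} → (Fin (suc k) → Carrier) → Fin k → Carrier
  Δ X p = X (Fin.suc p) - X (inject₁ p)

  ∑-telescope : ∀ {k} (X : Fin (suc k) → Carrier) (a b : Fin (suc k)) → toℕ a ℕ.≤ toℕ b →
    ∑[ p < k ] select (inRange? a b p) (Δ X p) ≡ X b - X a
  ∑-telescope {zero}  X 0F 0F _ = sym (-‿inverseʳ (X 0F))
  ∑-telescope {suc k} X 0F 0F _ =
    trans (∑-select-none (inRange? 0F 0F) (Δ X) (λ _ ())) (sym (-‿inverseʳ (X 0F)))
  ∑-telescope {suc k} X 0F (Fin.suc b) _ = begin
    select (inRange? 0F (Fin.suc b) 0F) (Δ X 0F)
      + ∑[ p < k ] select (inRange? 0F (Fin.suc b) (Fin.suc p)) (Δ X (Fin.suc p))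
      ≡⟨ cong₂ _+_ (select-yes (inRange? 0F (Fin.suc b) 0F) (ℕ.z≤n , ℕ.s≤s ℕ.z≤n) (Δ X 0F))
                   (sum-cong-≗ shift) ⟩
    Δ X 0F + ∑[ p < k ] select (inRange? 0F b p) (Δ (X ∘ Fin.suc) p)
      ≡⟨ cong (Δ X 0F +_) (∑-telescope (X ∘ Fin.suc) 0F b ℕ.z≤n) ⟩
    (X 1F - X 0F) + (X (Fin.suc b) - X 1F)
      ≡⟨ [y-x]+[z-y]≡z-x (X 0F) (X 1F) (X (Fin.suc b)) ⟩
    X (Fin.suc b) - X 0F ∎
    where
    open ≡-Reasoning
    shift : ∀ p → select (inRange? 0F (Fin.suc b) (Fin.suc p)) (Δ X (Fin.suc p))
                ≡ select (inRange? 0F b p) (Δ X (Fin.suc p))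
    shift p = select-cong (λ (_ , p<b) → ℕ.z≤n , ℕ.s<s⁻¹ p<b) (λ (_ , p<b) → ℕ.z≤n , ℕ.s<s p<b)
      (inRange? 0F (Fin.suc b) (Fin.suc p)) (inRange? 0F b p) (Δ X (Fin.suc p))
  ∑-telescope {suc k} X (Fin.suc a) (Fin.suc b) a≤b = begin
    select (inRange? (Fin.suc a) (Fin.suc b) 0F) (Δ X 0F)
      + ∑[ p < k ] select (inRange? (Fin.suc a) (Fin.suc b) (Fin.suc p)) (Δ X (Fin.suc p))
      ≡⟨ cong₂ _+_ (select-no (inRange? (Fin.suc a) (Fin.suc b) 0F) (λ ()) (Δ X 0F))
                   (sum-cong-≗ shift) ⟩
    0# + ∑[ p < k ] select (inRange? a b p) (Δ (X ∘ Fin.suc) p)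
      ≡⟨ +-identityˡ _ ⟩
    ∑[ p < k ] select (inRange? a b p) (Δ (X ∘ Fin.suc) p)
      ≡⟨ ∑-telescope (X ∘ Fin.suc) a b (ℕ.s≤s⁻¹ a≤b) ⟩
    X (Fin.suc b) - X (Fin.suc a) ∎
    where
    open ≡-Reasoning
    shift : ∀ p → select (inRange? (Fin.suc a) (Fin.suc b) (Fin.suc p)) (Δ X (Fin.suc p))
                ≡ select (inRange? a b p) (Δ X (Fin.suc p))
    shift p = select-cong (λ (a≤p , p<b) → ℕ.s≤s⁻¹ a≤p , ℕ.s<s⁻¹ p<b)
      (λ (a≤p , p<b) → ℕ.s≤s a≤p , ℕ.s<s p<b)
      (inRange? (Fin.suc a) (Fin.suc b) (Fin.suc p)) (inRange? a b p) (Δ X (Fin.suc p))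

  PairwiseSeparated : ∀ {k} (lo hi : Fin k → Carrier) → Pred (Fin k) 0ℓ → Set
  PairwiseSeparated lo hi P = ∀ {i j} → P i → P j → i ≢ j → hi i ≤ lo j ⊎ hi j ≤ lo i

  ∑-length≤ : ∀ {k} (lo hi : Fin k → Carrier) {P : Pred (Fin k) 0ℓ} (P? : Decidable P) {L T} →
    L ≤ T →
    (∀ {i} → P i → L ≤ lo i × hi i ≤ T) →
    PairwiseSeparated lo hi P →
    ∑[ i < k ] select (P? i) (hi i - lo i) ≤ T - L

  ∑-length-split≤ : ∀ {k} (lo hi : Fin k → Carrier) {P : Pred (Fin k) 0ℓ} (P? : Decidable P)
    {L a b T} → L ≤ a → b ≤ T →
    (∀ {i} → P i → L ≤ lo i × hi i ≤ T) →
    (∀ {i} → P i → hi i ≤ a ⊎ b ≤ lo i) →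
    PairwiseSeparated lo hi P →
    ∑[ i < k ] select (P? i) (hi i - lo i) ≤ (a - L) + (T - b)

  -- The first interval splits the others into those below it and those above it.
  ∑-length≤ {zero} lo hi P? L≤T _ _ = x≤y⇒0≤y-x L≤T
  ∑-length≤ {suc k} lo hi P? {L} {T} L≤T within separated with P? 0F
  ... | no _ = subst (_≤ T - L) (sym (+-identityˡ _))
    (∑-length≤ (lo ∘ Fin.suc) (hi ∘ Fin.suc) (P? ∘ Fin.suc) L≤T within
      (λ Pi Pj i≢j → separated Pi Pj (i≢j ∘ Fin.suc-injective)))
  ... | yes P₀ = begin
    (hi₀ - lo₀) + ∑[ i < k ] select (P? (Fin.suc i)) (hi (Fin.suc i) - lo (Fin.suc i))
      ≤⟨ +-monoʳ-≤ (hi₀ - lo₀) (∑-length-split≤ (lo ∘ Fin.suc) (hi ∘ Fin.suc) (P? ∘ Fin.suc)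
           (proj₁ (within P₀)) (proj₂ (within P₀)) within
           (λ Pi → swap (separated P₀ Pi λ ()))
           (λ Pi Pj i≢j → separated Pi Pj (i≢j ∘ Fin.suc-injective))) ⟩
    (hi₀ - lo₀) + ((lo₀ - L) + (T - hi₀))
      ≡⟨ x∙yz≈y∙xz (hi₀ - lo₀) (lo₀ - L) (T - hi₀) ⟩
    (lo₀ - L) + ((hi₀ - lo₀) + (T - hi₀))
      ≡⟨ cong ((lo₀ - L) +_) ([y-x]+[z-y]≡z-x lo₀ hi₀ T) ⟩
    (lo₀ - L) + (T - lo₀)
      ≡⟨ [y-x]+[z-y]≡z-x L lo₀ T ⟩
    T - L ∎
    where
    open ≤-Reasoning
    lo₀ hi₀ : Carrier
    lo₀ = lo 0F
    hi₀ = hi 0F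

  ∑-length-split≤ {k} lo hi P? {L} {a} {b} {T} L≤a b≤T within avoids separated = begin
    ∑[ i < k ] select (P? i) (length i)
      ≡⟨ ∑-select-split P? Below? length ⟩
    ∑[ i < k ] select (P? i ×-dec Below? i) (length i)
      + ∑[ i < k ] select (P? i ×-dec ¬? (Below? i)) (length i)
      ≤⟨ +-mono-≤ below above ⟩
    (a - L) + (T - b) ∎
    where
    open ≤-Reasoning
    length : Fin k → Carrier
    length i = hi i - lo i
    Below? : ∀ i → Dec (hi i ≤ a)
    Below? i = hi i ≤? a
    below : ∑[ i < k ] select (P? i ×-dec Below? i) (length i) ≤ a - L
    below = ∑-length≤ lo hi (λ i → P? i ×-dec Below? i) L≤a
      (λ (Pi , hi≤a) → proj₁ (within Pi) , hi≤a)
      (λ (Pi , _) (Pj , _) → separated Pi Pj)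
    above : ∑[ i < k ] select (P? i ×-dec ¬? (Below? i)) (length i) ≤ T - b
    above = ∑-length≤ lo hi (λ i → P? i ×-dec ¬? (Below? i)) b≤T
      (λ (Pi , hi≰a) → [ (λ hi≤a → contradiction hi≤a hi≰a) , (λ b≤lo → b≤lo) ]′ (avoids Pi)
                       , proj₂ (within Pi))
      (λ (Pi , _) (Pj , _) → separated Pi Pj)

  ∑-length-gap< : ∀ {k} (lo hi : Fin k → Carrier) {P : Pred (Fin k) 0ℓ} (P? : Decidable P)
    {L a b T} → L ≤ a → a < b → b ≤ T →
    (∀ {i} → P i → L ≤ lo i × hi i ≤ T) →
    (∀ {i} → P i → hi i ≤ a ⊎ b ≤ lo i) →
    PairwiseSeparated lo hi P →
    ∑[ i < k ] select (P? i) (hi i - lo i) < T - L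
  ∑-length-gap< {k} lo hi P? {L} {a} {b} {T} L≤a a<b b≤T within avoids separated = begin-strict
    ∑[ i < k ] select (P? i) (hi i - lo i)
      ≤⟨ ∑-length-split≤ lo hi P? L≤a b≤T within avoids separated ⟩
    (a - L) + (T - b)
      <⟨ +-mono-< (T - b) (+-mono-< (- L) a<b) ⟩
    (b - L) + (T - b)
      ≡⟨ [y-x]+[z-y]≡z-x L b T ⟩
    T - L ∎
    where open ≤-Reasoning

module Slabs (F : OrderedField) {k m : ℕ} (G : Graph (suc k) m)
  (ω : Fin m → OrderedField.Carrier F) (pos : Fin (suc k) → Fin (suc k))
  (R : TwoDim.Representation F (suc k) m)
  (simple : SimpleGraph G) (positive : TwoDim.PositiveWeights F ω)
  (embedding : TwoDim.IsTwoDimBookEmbedding F G ω pos R)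
  where

  open OrderedField F
  open Graph G
  open BookEmbedding G pos
  open TwoDim.Representation R
  open OrderedFieldProperties F
  open IntervalSums F

  no-loops : ∀ f → src f ≢ tgt f
  no-loops = proj₁ simple

  injective : IsLinearOrder
  injective = proj₁ (proj₁ embedding)

  no-crossing : NoCrossing
  no-crossing = proj₂ (proj₁ embedding)

  x-mono : ∀ u v → u ≺ v → x u < x v
  x-mono = proj₁ (proj₂ embedding)

  rect-area : ∀ f → (x (right f) - x (left f)) * (ymax f - ymin f) ≡ ω f
  rect-area = proj₁ (proj₂ (proj₂ (proj₂ embedding)))

  nested-below : ∀ f f′ → WrapsAround f f′ → ymax f′ ≤ ymin f
  nested-below f = proj₁ (proj₂ (proj₂ (proj₂ (proj₂ embedding))) f)

  left≺right : ∀ f → left f ≺ right f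
  left≺right f with toℕ (pos (src f)) ℕ.≤? toℕ (pos (tgt f))
  ... | yes s≤t = ℕ.≤∧≢⇒< s≤t (no-loops f ∘ injective ∘ Fin.toℕ-injective)
  ... | no s≰t = ℕ.≰⇒> s≰t

  x-≤⇒≼ : ∀ {u v} → x u ≤ x v → u ≼ v
  x-≤⇒≼ xu≤xv = ℕ.≮⇒≥ (λ v≺u → <-irrefl refl (<-≤-trans (x-mono _ _ v≺u) xu≤xv))

  ymin≤ymax : ∀ f → ymin f ≤ ymax f
  ymin≤ymax f = 0≤y-x⇒x≤y (0<x*y⇒0≤y (x<y⇒0<y-x (x-mono _ _ (left≺right f)))
                                      (subst (0# <_) (sym (rect-area f)) (positive f)))

  vertexAt : Fin (suc k) → Fin (suc k)
  vertexAt q = proj₁ (injective⇒strictlySurjective injective q)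

  pos∘vertexAt : ∀ q → pos (vertexAt q) ≡ q
  pos∘vertexAt q = proj₂ (injective⇒strictlySurjective injective q)

  xAt : Fin (suc k) → Carrier
  xAt q = x (vertexAt q)

  xAt∘pos : ∀ v → xAt (pos v) ≡ x v
  xAt∘pos v = cong x (injective (pos∘vertexAt (pos v)))

  slabWidth : Fin k → Carrier
  slabWidth = Δ xAt

  slabWidth-positive : ∀ p → 0# < slabWidth p
  slabWidth-positive p = x<y⇒0<y-x (x-mono _ _ (subst₂ ℕ._<_
    (sym (trans (cong toℕ (pos∘vertexAt (inject₁ p))) (Fin.toℕ-inject₁ p)))
    (sym (cong toℕ (pos∘vertexAt (Fin.suc p))))
    (ℕ.n<1+n (toℕ p))))

  Spans : Fin m → Pred (Fin k) 0ℓ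
  Spans f = InRange (pos (left f)) (pos (right f))

  spans? : ∀ f → Decidable (Spans f)
  spans? f = inRange? (pos (left f)) (pos (right f))

  height : Fin m → Carrier
  height f = ymax f - ymin f

  columnHeight : Fin k → Carrier
  columnHeight p = ∑[ f < m ] select (spans? f p) (height f)

  width≡∑slabWidth : ∀ f → x (right f) - x (left f) ≡ ∑[ p < k ] select (spans? f p) (slabWidth p)
  width≡∑slabWidth f = sym (trans
    (∑-telescope xAt (pos (left f)) (pos (right f)) (ℕ.<⇒≤ (left≺right f)))
    (cong₂ _-_ (xAt∘pos (right f)) (xAt∘pos (left f))))

  ∑ω≡∑slabWidth*columnHeight : TwoDim.sumF F ω ≡ ∑[ p < k ] (slabWidth p * columnHeight p)
  ∑ω≡∑slabWidth*columnHeight = begin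
    TwoDim.sumF F ω
      ≡⟨ sumF≡sum ω ⟩
    ∑[ f < m ] ω f
      ≡⟨ sum-cong-≗ (λ f → sym (rect-area f)) ⟩
    ∑[ f < m ] ((x (right f) - x (left f)) * height f)
      ≡⟨ sum-cong-≗ (λ f → cong (_* height f) (width≡∑slabWidth f)) ⟩
    ∑[ f < m ] ((∑[ p < k ] select (spans? f p) (slabWidth p)) * height f)
      ≡⟨ sum-cong-≗ (λ f → *-distribʳ-sum (height f) (λ p → select (spans? f p) (slabWidth p))) ⟩
    ∑[ f < m ] ∑[ p < k ] (select (spans? f p) (slabWidth p) * height f)
      ≡⟨ sum-cong-≗ (λ f → sum-cong-≗ (λ p → select-*-comm (spans? f p) (slabWidth p) (height f))) ⟩
    ∑[ f < m ] ∑[ p < k ] (slabWidth p * select (spans? f p) (height f))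
      ≡⟨ ∑-comm (λ f p → slabWidth p * select (spans? f p) (height f)) ⟩
    ∑[ p < k ] ∑[ f < m ] (slabWidth p * select (spans? f p) (height f))
      ≡⟨ sum-cong-≗ (λ p → *-distribˡ-sum (slabWidth p) (λ f → select (spans? f p) (height f))) ⟨
    ∑[ p < k ] (slabWidth p * columnHeight p) ∎
    where open ≡-Reasoning

  wraps⇒spans : ∀ {f f′ p} → WrapsAround f f′ → Spans f′ p → Spans f p
  wraps⇒spans (_ , lf≼lf′ , _ , rf′≼rf) (lf′≤p , p<rf′) =
    ℕ.≤-trans lf≼lf′ lf′≤p , ℕ.<-≤-trans p<rf′ rf′≼rf

  spans-common⇒nested : ∀ {f f′ p} → f ≢ f′ → Spans f p → Spans f′ p →
    WrapsAround f f′ ⊎ WrapsAround f′ f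
  spans-common⇒nested {f} {f′} f≢f′ (lf≤p , p<rf) (lf′≤p , p<rf′)
    with ℕ.<-cmp (toℕ (pos (left f))) (toℕ (pos (left f′)))
  ... | tri< lf≺lf′ _ _ = inj₁ (f≢f′ , ℕ.<⇒≤ lf≺lf′ , ℕ.≤-<-trans lf′≤p p<rf′ ,
          ℕ.≮⇒≥ (λ rf≺rf′ → no-crossing f f′ (lf≺lf′ , ℕ.≤-<-trans lf′≤p p<rf , rf≺rf′)))
  ... | tri> _ _ lf′≺lf = inj₂ (f≢f′ ∘ sym , ℕ.<⇒≤ lf′≺lf , ℕ.≤-<-trans lf≤p p<rf ,
          ℕ.≮⇒≥ (λ rf′≺rf → no-crossing f′ f (lf′≺lf , ℕ.≤-<-trans lf≤p p<rf′ , rf′≺rf)))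
  ... | tri≈ _ lf≡lf′ _ with ℕ.≤-total (toℕ (pos (right f′))) (toℕ (pos (right f)))
  ...   | inj₁ rf′≼rf = inj₁ (f≢f′ , ℕ.≤-reflexive lf≡lf′ , ℕ.≤-<-trans lf′≤p p<rf′ , rf′≼rf)
  ...   | inj₂ rf≼rf′ = inj₂ (f≢f′ ∘ sym , ℕ.≤-reflexive (sym lf≡lf′) , ℕ.≤-<-trans lf≤p p<rf , rf≼rf′)

  spans-common⇒separated : ∀ p → PairwiseSeparated ymin ymax (λ f → Spans f p)
  spans-common⇒separated p {f} {f′} sf sf′ f≢f′ with spans-common⇒nested f≢f′ sf sf′
  ... | inj₁ f⊃f′ = inj₂ (nested-below f f′ f⊃f′)
  ... | inj₂ f′⊃f = inj₁ (nested-below f′ f f′⊃f)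

  firstSlab : Fin m → Fin k
  firstSlab f = fromℕ< (ℕ.<-≤-trans (left≺right f) (ℕ.s≤s⁻¹ (Fin.toℕ<n (pos (right f)))))

  firstSlab-spanned : ∀ f → Spans f (firstSlab f)
  firstSlab-spanned f = subst (λ p → toℕ (pos (left f)) ℕ.≤ p × p ℕ.< toℕ (pos (right f)))
    (sym (Fin.toℕ-fromℕ< _)) (ℕ.≤-refl , left≺right f)

  directly-wraps⇒avoids-gap : ∀ {e e′ f} → DirectlyWrapsAround e e′ → Spans f (firstSlab e′) →
    ymax f ≤ ymax e′ ⊎ ymin e ≤ ymin f
  directly-wraps⇒avoids-gap {e} {e′} {f} (e⊃e′ , direct) sf with f Fin.≟ e′
  ... | yes refl = inj₁ ≤-refl
  ... | no f≢e′ with spans-common⇒nested f≢e′ sf (firstSlab-spanned e′)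
  ...   | inj₂ e′⊃f = inj₁ (≤-trans (nested-below e′ f e′⊃f) (ymin≤ymax e′))
  ...   | inj₁ f⊃e′ with f Fin.≟ e
  ...     | yes refl = inj₂ ≤-refl
  ...     | no f≢e with spans-common⇒nested f≢e sf (wraps⇒spans e⊃e′ (firstSlab-spanned e′))
  ...       | inj₁ f⊃e = inj₂ (≤-trans (ymin≤ymax e) (nested-below f e f⊃e))
  ...       | inj₂ e⊃f = contradiction (f , e⊃f , f⊃e′) direct

  module BoundingBox {X₀ X₁ Y₀ Y₁ : Carrier}
    (leftmost  : TwoDim.IsMinOf F (λ f → x (left f)) X₀)
    (rightmost : TwoDim.IsMaxOf F (λ f → x (right f)) X₁)
    (lowest    : TwoDim.IsMinOf F ymin Y₀)
    (highest   : TwoDim.IsMaxOf F ymax Y₁)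
    where

    boxHeight : Carrier
    boxHeight = Y₁ - Y₀

    private
      f₀ f₁ : Fin m
      f₀ = proj₁ (proj₁ leftmost)
      f₁ = proj₁ (proj₁ rightmost)

      leftmost-≼ : ∀ f → left f₀ ≼ left f
      leftmost-≼ f = x-≤⇒≼ (subst (_≤ x (left f)) (sym (proj₂ (proj₁ leftmost))) (proj₂ leftmost f))

      ≼-rightmost : ∀ f → right f ≼ right f₁
      ≼-rightmost f = x-≤⇒≼ (subst (x (right f) ≤_) (sym (proj₂ (proj₁ rightmost))) (proj₂ rightmost f))

      y-inBox : ∀ f → Y₀ ≤ ymin f × ymax f ≤ Y₁
      y-inBox f = proj₂ lowest f , proj₂ highest f

    InBox : Pred (Fin k) 0ℓ
    InBox = InRange (pos (left f₀)) (pos (right f₁))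

    inBox? : Decidable InBox
    inBox? = inRange? (pos (left f₀)) (pos (right f₁))

    spans⇒inBox : ∀ {f p} → Spans f p → InBox p
    spans⇒inBox {f} (lf≤p , p<rf) = ℕ.≤-trans (leftmost-≼ f) lf≤p , ℕ.<-≤-trans p<rf (≼-rightmost f)

    ∑inBox-slabWidth≡boxWidth : ∑[ p < k ] select (inBox? p) (slabWidth p) ≡ X₁ - X₀
    ∑inBox-slabWidth≡boxWidth = trans
      (∑-telescope xAt (pos (left f₀)) (pos (right f₁))
        (ℕ.≤-trans (leftmost-≼ f₁) (ℕ.<⇒≤ (left≺right f₁))))
      (cong₂ _-_ (trans (xAt∘pos (right f₁)) (proj₂ (proj₁ rightmost)))
                 (trans (xAt∘pos (left f₀)) (proj₂ (proj₁ leftmost))))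

    columnHeight≤boxHeight : ∀ p → columnHeight p ≤ boxHeight
    columnHeight≤boxHeight p = ∑-length≤ ymin ymax (λ f → spans? f p)
      (≤-trans (proj₁ (y-inBox f₀)) (≤-trans (ymin≤ymax f₀) (proj₂ (y-inBox f₀))))
      (λ {f} _ → y-inBox f) (spans-common⇒separated p)

    slabArea≤ : ∀ p → slabWidth p * columnHeight p ≤ select (inBox? p) (slabWidth p) * boxHeight
    slabArea≤ p with inBox? p
    ... | yes _ = *-monoʳ-≤ (inj₁ (slabWidth-positive p)) (columnHeight≤boxHeight p)
    ... | no outside = inj₂ (begin
      slabWidth p * columnHeight p  ≡⟨ cong (slabWidth p *_) empty-column ⟩
      slabWidth p * 0#              ≡⟨ zeroʳ (slabWidth p) ⟩
      0#                            ≡⟨ zeroˡ boxHeight ⟨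
      0# * boxHeight                ∎)
      where
      open ≡-Reasoning
      empty-column : columnHeight p ≡ 0#
      empty-column = ∑-select-none (λ f → spans? f p) height (λ f → outside ∘ spans⇒inBox)

    short-column⇒area< : ∀ {f p} → Spans f p → columnHeight p < boxHeight →
      TwoDim.sumF F ω < (X₁ - X₀) * (Y₁ - Y₀)
    short-column⇒area< {f} {p} sp short = begin-strict
      TwoDim.sumF F ω
        ≡⟨ ∑ω≡∑slabWidth*columnHeight ⟩
      ∑[ q < k ] (slabWidth q * columnHeight q)
        <⟨ ∑-mono-< slabArea≤ p slabArea< ⟩
      ∑[ q < k ] (select (inBox? q) (slabWidth q) * boxHeight)
        ≡⟨ *-distribʳ-sum boxHeight (λ q → select (inBox? q) (slabWidth q)) ⟨
      (∑[ q < k ] select (inBox? q) (slabWidth q)) * boxHeight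
        ≡⟨ cong (_* boxHeight) ∑inBox-slabWidth≡boxWidth ⟩
      (X₁ - X₀) * (Y₁ - Y₀) ∎
      where
      open ≤-Reasoning
      slabArea< : slabWidth p * columnHeight p < select (inBox? p) (slabWidth p) * boxHeight
      slabArea< = subst (λ w → slabWidth p * columnHeight p < w * boxHeight)
        (sym (select-yes (inBox? p) (spans⇒inBox sp) (slabWidth p)))
        (*-monoʳ-< (slabWidth-positive p) short)

    gap⇒short-column : ∀ {e e′} → DirectlyWrapsAround e e′ → ymax e′ < ymin e →
      columnHeight (firstSlab e′) < boxHeight
    gap⇒short-column {e} {e′} directly gap = ∑-length-gap< ymin ymax (λ f → spans? f (firstSlab e′))
      (≤-trans (proj₁ (y-inBox e′)) (ymin≤ymax e′)) gap
      (≤-trans (ymin≤ymax e) (proj₂ (y-inBox e)))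
      (λ {f} _ → y-inBox f) (directly-wraps⇒avoids-gap directly)
      (spans-common⇒separated (firstSlab e′))

mainTheorem11 : (F : OrderedField) {n m : ℕ} (G : Graph n m) (ω : Fin m → OrderedField.Carrier F) →
    SimpleGraph G → TwoDim.PositiveWeights F ω → Biconnected G → Outerplanar G →
    (pos : Fin n → Fin n) (R : TwoDim.Representation F n m) →
    TwoDim.IsTwoDimBookEmbedding F G ω pos R →
    TwoDim.HasArea F G ω pos R (TwoDim.sumF F ω) →
    (e e' : Fin m) → BookEmbedding.DirectlyWrapsAround G pos e e' →
    TwoDim.Representation.ymin R e ≡ TwoDim.Representation.ymax R e'
mainTheorem11 F {zero} G _ _ _ _ _ _ _ _ _ e _ _ = ⊥-elim (Fin.¬Fin0 (Graph.src G e))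
mainTheorem11 F {suc k} G ω simple positive _ _ pos R embedding
  (X₀ , X₁ , Y₀ , Y₁ , leftmost , rightmost , lowest , highest , box) e e′ directly@(e⊃e′ , _) =
  case nested-below e e′ e⊃e′ of λ where
    (inj₂ touching) → sym touching
    (inj₁ gap) → begin-contradiction
      TwoDim.sumF F ω
        <⟨ short-column⇒area< (firstSlab-spanned e′) (gap⇒short-column directly gap) ⟩
      (X₁ - X₀) * (Y₁ - Y₀)
        ≡⟨ box ⟩
      TwoDim.sumF F ω ∎
  where
  open OrderedField F
  open OrderedFieldProperties F using (module ≤-Reasoning)
  open ≤-Reasoning
  open Slabs F G ω pos R simple positive embedding
  open BoundingBox leftmost rightmost lowest highest
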